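{- Consider a run of algorithm u-red on an edge-uncertainty graph $\mathcal{U}$. Let $h=\{u,v\}$ and $e$ be two edges of $\mathcal{U}$ with $h\neq e$ and $L_h<U_e$. If the algorithm is at a point of the current run at which $h$ has already been considered (i.e. added to $\mathcal{G}$ in line 04), then $u$ and $v$ are connected in the current graph $\mathcal{G}-\{e\}$.
   Context: An edge-uncertainty graph is a finite connected undirected graph $\mathcal{U}=(V,E)$ with, for each edge $e$, a nonempty area $A_e\subseteq\mathbb{R}$ containing the unknown weight $w_e$; $U_e=\sup A_e$, $L_e=\inf A_e$. Updating an edge $e$ reveals $w_e$ and replaces $A_e$ by $\{w_e\}$. For a cycle $C$, an edge $e\in C$ is always maximal in $C$ if $L_e\ge U_c$ for all $c\in C\setminus\{e\}$. Order edges by: $e<f$ if $L_e<L_f$ or ($L_e=L_f$ and $U_e<U_f$); $e\le f$ if $e<f$ or ($L_e=L_f$ and $U_e=U_f$), edges with equal limits ordered arbitrarily. Algorithm u-red: (01) index the edges so that $e_1\le e_2\le\dots\le e_m$; (02) let $\mathcal{G}$ be the graph on $V$ with no edges; (03) for $i=1$ to $m$: (04) add $e_i$ to $\mathcal{G}$; (05) if $\mathcal{G}$ has a cycle $C$ then (06–07) if $C$ contains an always maximal edge $e$, delete $e$ from $\mathcal{G}$; (08–12) otherwise let $f\in C$ with $U_f=\max\{U_c\mid c\in C\}$, let $g\in C\setminus\{f\}$ with $U_g>L_f$, update $f$ and $g$, and restart the algorithm from line 01 with the new areas; (16) after the loop, return $\mathcal{G}$. A run is the execution between two consecutive (re)starts,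 or between the last (re)start and termination. -}

module Defs where

open import Level using (0ℓ)
open import Data.Nat using (ℕ)
open import Data.Fin using (Fin)
open import Data.Fin.Subset using (Subset; Side; inside; outside) renaming (_∈_ to _∈ₛ_; ⊥ to ∅)
open import Data.Vec.Base using (_[_]≔_)
open import Data.List.Base using (List; []; _∷_; _∷ʳ_; _++_; allFin)
open import Data.List.Membership.Propositional using (_∈_)
open import Data.List.Relation.Unary.Unique.Propositional using (Unique)
open import Data.List.Relation.Unary.AllPairs using (AllPairs)
open import Data.List.Relation.Binary.Permutation.Propositional using (_↭_)
open import Data.Product using (Σ; ∃; ∃-syntax; _×_; _,_; proj₁; proj₂)
open import Data.Sum using (_⊎_)
open import Data.Unit using (⊤)
open import Relation.Binary.PropositionalEquality using (_≡_; _≢_)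
open import Relation.Binary.Bundles using (TotalOrder)
open import Relation.Nullary using (¬_)

Joins : {n m : ℕ} → (Fin m → Fin n × Fin n) → Fin m → Fin n → Fin n → Set
Joins ends f x y = ends f ≡ (x , y) ⊎ ends f ≡ (y , x)

data Walk {n m : ℕ} (ends : Fin m → Fin n × Fin n) (S : Fin m → Set)
     : Fin n → Fin n → List (Fin m) → List (Fin n) → Set where
  stop : ∀ {x} → Walk ends S x x [] (x ∷ [])
  step : ∀ {x y z f es vs} → S f → Joins ends f x y →
         Walk ends S y z es vs → Walk ends S x z (f ∷ es) (x ∷ vs)

Connected : {n m : ℕ} → (Fin m → Fin n × Fin n) → (Fin m → Set) → Fin n → Fin n → Set
Connected ends S x y = ∃[ es ] ∃[ vs ] Walk ends S x y es vs

AllEdges : {m : ℕ} → Fin m → Set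
AllEdges _ = ⊤

-- Edge-uncertainty graphs over a totally ordered value set T
-- (the extended reals in the paper; only the limits L_e = inf A_e and
-- U_e = sup A_e of the areas enter the algorithm within one run).

record EUGraph (T : TotalOrder 0ℓ 0ℓ 0ℓ) : Set₁ where
  open TotalOrder T
  field
    n m   : ℕ
    ends  : Fin m → Fin n × Fin n
    L U   : Fin m → Carrier
    noLoop    : ∀ f → proj₁ (ends f) ≢ proj₂ (ends f)
    noParallel : ∀ f g x y → Joins ends f x y → Joins ends g x y → f ≡ g
    connected : ∀ x y → Connected ends AllEdges x y
    -- nonempty areas: inf ≤ sup
    L≤U : ∀ f → L f ≤ U f

module URed {T : TotalOrder 0ℓ 0ℓ 0ℓ} (𝒰 : EUGraph T) where
  open TotalOrder T
  open EUGraph 𝒰 public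

  _<ᵀ_ : Carrier → Carrier → Set
  x <ᵀ y = x ≤ y × ¬ (y ≤ x)

  _≺_ : Fin m → Fin m → Set
  e ≺ f = L e <ᵀ L f ⊎ (L e ≈ L f × U e <ᵀ U f)

  _≼_ : Fin m → Fin m → Set
  e ≼ f = e ≺ f ⊎ (L e ≈ L f × U e ≈ U f)

  -- line 01: an indexing e₁ ≼ e₂ ≼ … ≼ eₘ of all edges
  SortedOrder : List (Fin m) → Set
  SortedOrder es = (es ↭ allFin m) × AllPairs _≼_ es

  Graph : Set
  Graph = Subset m

  InG : Graph → Fin m → Set
  InG G f = f ∈ₛ G

  Minus : Graph → Fin m → Fin m → Set
  Minus G e f = f ∈ₛ G × f ≢ e

  Cycle : Graph → List (Fin m) → Set
  Cycle G C = ∃[ f ] ∃[ a ] ∃[ b ] ∃[ es ] ∃[ vs ]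
    (C ≡ f ∷ es × f ∈ₛ G × Joins ends f a b ×
     Walk ends (Minus G f) b a es vs × Unique vs)

  AlwaysMaximal : List (Fin m) → Fin m → Set
  AlwaysMaximal C e = e ∈ C × (∀ c → c ∈ C → c ≢ e → U c ≤ L e)

  addEdge : Graph → Fin m → Graph
  addEdge G f = G [ f ]≔ inside

  delEdge : Graph → Fin m → Graph
  delEdge G f = G [ f ]≔ outside

  -- lines 04–07 of one loop iteration that does NOT cause a restart:
  -- add f, and if a cycle arises it has an always maximal edge which is deleted.
  data Iter (G : Graph) (f : Fin m) : Graph → Set where
    noCycle : (¬ (∃[ C ] Cycle (addEdge G f) C)) → Iter G f (addEdge G f)
    delete  : ∀ C e → Cycle (addEdge G f) C → AlwaysMaximal C e →
              Iter G f (delEdge (addEdge G f) e)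

  -- Runs ps G : within the current run, after having completed the
  -- iterations for the edges ps (in this order), the current graph is G.
  data Runs : List (Fin m) → Graph → Set where
    start : Runs [] ∅
    next  : ∀ {ps G f G'} → Runs ps G → Iter G f G' → Runs (ps ∷ʳ f) G'

  -- Point ps G : a point of the current run at which exactly the edges ps
  -- have been added in line 04 (in this order) and the current graph is G.
  -- Either between iterations, or right after line 04 of an iteration
  -- (before the cycle test / deletion / restart).
  data Point : List (Fin m) → Graph → Set where
    between  : ∀ {ps G} → Runs ps G → Point ps G
    afterAdd : ∀ {ps G f} → Runs ps G → Point (ps ∷ʳ f) (addEdge G f)

module Submission where

-- Call an edge c "h-light" if c = h or
-- U c ≤ L h.  Along a run of u-red we maintain the invariant
--   (I) for every edge h = {u,v} added so far, u and v are joined in the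
--       current graph 𝒢 by a walk all of whose edges are h-light.
-- (I) holds for the empty graph and survives line 04, since adding an edge
-- only enlarges 𝒢 and the new edge is light for itself.  It survives the
-- deletion in line 07: an edge d that is always maximal on a cycle C can be
-- bypassed by the rest of C, whose edges c satisfy U c ≤ L d, and every such
-- c is h-light whenever d is (as L d ≤ U d).  Finally, if h ≠ e and
-- L h < U e then e is not h-light, so the walk given by (I) avoids e.

open import Defs
open import Level using (0ℓ)
open import Data.Nat using (ℕ)
open import Data.Fin using (Fin; _≟_)
open import Data.Vec.Properties using ([]≔-updates; []≔-minimal)
open import Data.List.Base using (List; []; _∷_; _∷ʳ_; _++_)
open import Data.List.Membership.Propositional using (_∈_; _∉_)
open import Data.List.Membership.Propositional.Properties using (∈-++⁻)
open import Data.List.Relation.Unary.Any using (here; there)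
open import Data.List.Relation.Unary.All using (All)
import Data.List.Relation.Unary.All as All
open import Data.List.Relation.Unary.AllPairs using (_∷_)
open import Data.List.Relation.Unary.Unique.Propositional using (Unique)
open import Data.Product using (_×_; _,_; proj₁; proj₂; swap; map₁; map₂)
open import Data.Product.Properties using (×-≡,≡←≡)
open import Data.Sum using (_⊎_; inj₁; inj₂)
import Data.Sum as Sum
open import Relation.Nullary using (yes; no)
open import Relation.Binary.PropositionalEquality using (_≡_; _≢_; refl; sym; trans; cong; subst)
open import Relation.Binary.Bundles using (TotalOrder)

module Walks {n m : ℕ} (ends : Fin m → Fin n × Fin n) where

  joins-sym : ∀ {g x y} → Joins ends g x y → Joins ends g y x
  joins-sym (inj₁ p) = inj₂ p
  joins-sym (inj₂ p) = inj₁ p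

  joins-unique : ∀ {g x y x′ y′} → Joins ends g x y → Joins ends g x′ y′ →
                 (x ≡ x′ × y ≡ y′) ⊎ (x ≡ y′ × y ≡ x′)
  joins-unique (inj₁ p) (inj₁ q) = inj₁ (×-≡,≡←≡ (trans (sym p) q))
  joins-unique (inj₁ p) (inj₂ q) = inj₂ (×-≡,≡←≡ (trans (sym p) q))
  joins-unique (inj₂ p) (inj₁ q) = inj₂ (swap (×-≡,≡←≡ (trans (sym p) q)))
  joins-unique (inj₂ p) (inj₂ q) = inj₁ (swap (×-≡,≡←≡ (trans (sym p) q)))

  Avoiding : (Fin m → Set) → Fin m → Fin m → Set
  Avoiding S d c = S c × c ≢ d

  walk-weaken : ∀ {S S′ : Fin m → Set} {x z es vs} →
                (∀ c → c ∈ es → S c → S′ c) →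
                Walk ends S x z es vs → Walk ends S′ x z es vs
  walk-weaken S⊆S′ stop         = stop
  walk-weaken S⊆S′ (step s j w) =
    step (S⊆S′ _ (here refl) s) j (walk-weaken (λ c c∈ → S⊆S′ c (there c∈)) w)

  walk-edges : ∀ {S x z es vs c} → Walk ends S x z es vs → c ∈ es → S c
  walk-edges (step s _ _) (here refl) = s
  walk-edges (step _ _ w) (there c∈)  = walk-edges w c∈

  connected-weaken : ∀ {S S′ : Fin m → Set} {x z} → (∀ c → S c → S′ c) →
                     Connected ends S x z → Connected ends S′ x z
  connected-weaken S⊆S′ (es , vs , w) = es , vs , walk-weaken (λ c _ → S⊆S′ c) w

  connected-refl : ∀ {S x} → Connected ends S x x
  connected-refl = [] , _ , stop

  connected-edge : ∀ {S : Fin m → Set} {g x y} → S g → Joins ends g x y →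
                   Connected ends S x y
  connected-edge s j = _ , _ , step s j stop

  connected-trans : ∀ {S x y z} → Connected ends S x y → Connected ends S y z →
                    Connected ends S x z
  connected-trans (_ , _ , stop)       c = c
  connected-trans (_ , _ , step s j w) c with connected-trans (_ , _ , w) c
  ... | es , vs , w′ = _ , _ , step s j w′

  connected-sym : ∀ {S x y} → Connected ends S x y → Connected ends S y x
  connected-sym (_ , _ , stop)       = connected-refl
  connected-sym (_ , _ , step s j w) =
    connected-trans (connected-sym (_ , _ , w)) (connected-edge s (joins-sym j))

  connected-endpoints : ∀ {S g x y x′ y′} → Joins ends g x y → Joins ends g x′ y′ →
                        Connected ends S x′ y′ → Connected ends S x y
  connected-endpoints j j′ c with joins-unique j j′
  ... | inj₁ (refl , refl) = c
  ... | inj₂ (refl , refl) = connected-sym c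

  walk-source-visited : ∀ {S x z es vs} → Walk ends S x z es vs → x ∈ vs
  walk-source-visited stop         = here refl
  walk-source-visited (step _ _ _) = here refl

  walk-endpoints-visited : ∀ {S x z es vs g} → Walk ends S x z es vs → g ∈ es →
                           proj₁ (ends g) ∈ vs × proj₂ (ends g) ∈ vs
  walk-endpoints-visited (step _ j w) (here refl) =
    endpoints j (here refl) (there (walk-source-visited w))
    where
    endpoints : ∀ {g x y xs} → Joins ends g x y → x ∈ xs → y ∈ xs →
                proj₁ (ends g) ∈ xs × proj₂ (ends g) ∈ xs
    endpoints (inj₁ p) x∈ y∈ rewrite p = x∈ , y∈
    endpoints (inj₂ p) x∈ y∈ rewrite p = y∈ , x∈
  walk-endpoints-visited (step _ _ w) (there g∈) =
    map₁ there (map₂ there (walk-endpoints-visited w g∈))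

  unvisited-edge : ∀ {S y z es vs g x x′} → Walk ends S y z es vs →
                   All (x ≢_) vs → Joins ends g x x′ → g ∉ es
  unvisited-edge w x∉ (inj₁ p) g∈ =
    All.lookup x∉ (subst (_∈ _) (cong proj₁ p) (proj₁ (walk-endpoints-visited w g∈))) refl
  unvisited-edge w x∉ (inj₂ p) g∈ =
    All.lookup x∉ (subst (_∈ _) (cong proj₂ p) (proj₂ (walk-endpoints-visited w g∈))) refl

  tail-avoids : ∀ {S y z es vs g x x′} → Walk ends S y z es vs →
                All (x ≢_) vs → Joins ends g x x′ → Walk ends (Avoiding S g) y z es vs
  tail-avoids w x∉ j = walk-weaken (λ c c∈ sc → sc , λ { refl → unvisited-edge w x∉ j c∈ }) w

  path-split : ∀ {S b a es vs d x y} → Walk ends S b a es vs → Unique vs →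
               d ∈ es → Joins ends d x y →
               (Connected ends (Avoiding S d) b x × Connected ends (Avoiding S d) y a) ⊎
               (Connected ends (Avoiding S d) b y × Connected ends (Avoiding S d) x a)
  path-split (step s j w) (b∉ ∷ _) (here refl) jd with joins-unique jd j
  ... | inj₁ (refl , refl) = inj₁ (connected-refl , _ , _ , tail-avoids w b∉ j)
  ... | inj₂ (refl , refl) = inj₂ (connected-refl , _ , _ , tail-avoids w b∉ j)
  path-split {S} {b} {d = d} (step {y = b′} s j w) (b∉ ∷ unique) (there d∈) jd =
    Sum.map (map₁ extend) (map₁ extend) (path-split w unique d∈ jd)
    where
    extend : ∀ {z} → Connected ends (Avoiding S d) b′ z → Connected ends (Avoiding S d) b z
    extend = connected-trans (connected-edge (s , λ { refl → unvisited-edge w b∉ j d∈ }) j)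

  cycle-detour : ∀ {S f a b es vs d x y} → S f → Joins ends f a b →
                 Walk ends (Avoiding S f) b a es vs → Unique vs →
                 d ∈ f ∷ es → Joins ends d x y →
                 Connected ends (Avoiding (λ c → S c × c ∈ f ∷ es) d) x y
  cycle-detour sf jf w unique (here refl) jd =
    connected-endpoints jd (joins-sym jf)
      (_ , _ , walk-weaken (λ c c∈ (sc , c≢f) → (sc , there c∈) , c≢f) w)
  cycle-detour sf jf w unique (there d∈) jd
    with proj₂ (walk-edges w d∈)
       | path-split (walk-weaken (λ c c∈ (sc , _) → sc , there c∈) w) unique d∈ jd
  ... | d≢f | inj₁ (b⇝x , y⇝a) =
        connected-trans (connected-sym b⇝x)
          (connected-trans (connected-edge ((sf , here refl) , λ { refl → d≢f refl }) (joins-sym jf))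
                           (connected-sym y⇝a))
  ... | d≢f | inj₂ (b⇝y , x⇝a) =
        connected-trans x⇝a
          (connected-trans (connected-edge ((sf , here refl) , λ { refl → d≢f refl }) jf) b⇝y)

module LightInvariant {T : TotalOrder 0ℓ 0ℓ 0ℓ} (𝒰 : EUGraph T) where
  open URed 𝒰
  open TotalOrder T using (_≤_) renaming (trans to ≤-trans)
  open Walks ends

  Light : Fin m → Fin m → Set
  Light h c = c ≡ h ⊎ U c ≤ L h

  light-below : ∀ {h d c} → Light h d → U c ≤ L d → Light h c
  light-below (inj₁ refl) c≤d = inj₂ c≤d
  light-below {d = d} (inj₂ d≤h) c≤d = inj₂ (≤-trans c≤d (≤-trans (L≤U d) d≤h))

  light-not-heavy : ∀ {h e c} → h ≢ e → L h <ᵀ U e → Light h c → c ≢ e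
  light-not-heavy h≢e _         (inj₁ refl) refl = h≢e refl
  light-not-heavy _   (_ , e≰h) (inj₂ e≤h)  refl = e≰h e≤h

  LightIn : Graph → Fin m → Fin m → Set
  LightIn G h c = InG G c × Light h c

  Invariant : Graph → List (Fin m) → Set
  Invariant G ps = ∀ h → h ∈ ps → ∀ {u v} → Joins ends h u v →
                   Connected ends (LightIn G h) u v

  addEdge-keeps : ∀ G f c → InG G c → InG (addEdge G f) c
  addEdge-keeps G f c c∈G with c ≟ f
  ... | yes refl = []≔-updates G c
  ... | no  c≢f  = []≔-minimal G c f c≢f c∈G

  invariant-add : ∀ {G ps} f → Invariant G ps → Invariant (addEdge G f) (ps ∷ʳ f)
  invariant-add {G} {ps} f inv h h∈ j with ∈-++⁻ ps h∈
  ... | inj₁ h∈ps = connected-weaken (λ c → map₁ (addEdge-keeps G f c)) (inv h h∈ps j)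
  ... | inj₂ (here refl) = connected-edge ([]≔-updates G h , inj₁ refl) j

  always-maximal-detour : ∀ {G C d x y} → Cycle G C → AlwaysMaximal C d →
                          Joins ends d x y →
                          Connected ends (λ c → InG G c × c ≢ d × U c ≤ L d) x y
  always-maximal-detour {G} (f , a , b , es , vs , refl , f∈G , jf , w , unique) (d∈C , maximal) jd =
    connected-weaken (λ c ((c∈G , c∈C) , c≢d) → c∈G , c≢d , maximal c c∈C c≢d)
                     (cycle-detour {S = InG G} f∈G jf w unique d∈C jd)

  -- Deleting an always maximal edge d of a cycle keeps every h-light walk
  -- connected: each use of d is replaced by the detour around the cycle.
  light-reroute : ∀ {G C d h x z es vs} → Cycle G C → AlwaysMaximal C d →
                  Walk ends (LightIn G h) x z es vs →
                  Connected ends (LightIn (delEdge G d) h) x z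
  light-reroute cycle maximal stop = connected-refl
  light-reroute {G} {d = d} cycle maximal (step {f = g} (g∈G , light) j w) with g ≟ d
  ... | no g≢d =
        connected-trans (connected-edge ([]≔-minimal G g d g≢d g∈G , light) j)
                        (light-reroute cycle maximal w)
  ... | yes refl =
        connected-trans
          (connected-weaken (λ c (c∈G , c≢d , c≤d) → []≔-minimal G c d c≢d c∈G , light-below light c≤d)
                            (always-maximal-detour cycle maximal j))
          (light-reroute cycle maximal w)

  invariant-delete : ∀ {G ps C d} → Invariant G ps → Cycle G C → AlwaysMaximal C d →
                     Invariant (delEdge G d) ps
  invariant-delete inv cycle maximal h h∈ j =
    light-reroute cycle maximal (proj₂ (proj₂ (inv h h∈ j)))

  runs-invariant : ∀ {ps G} → Runs ps G → Invariant G ps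
  runs-invariant start h ()
  runs-invariant (next {f = f} r (noCycle _)) = invariant-add f (runs-invariant r)
  runs-invariant (next {f = f} r (delete C d cycle maximal)) =
    invariant-delete (invariant-add f (runs-invariant r)) cycle maximal

  point-invariant : ∀ {ps G} → Point ps G → Invariant G ps
  point-invariant (between r)          = runs-invariant r
  point-invariant (afterAdd {f = f} r) = invariant-add f (runs-invariant r)

-- Lemma 3.4: by (I), u and v are joined by h-light edges of 𝒢, none of
-- which is e.
lemma3p4 : {T : TotalOrder 0ℓ 0ℓ 0ℓ} (𝒰 : EUGraph T) →
    let open URed 𝒰 in
    (order : List (Fin m)) → SortedOrder order →
    (ps rest : List (Fin m)) → order ≡ ps ++ rest →
    (G : Graph) → Point ps G →
    (h e : Fin m) (u v : Fin n) → Joins ends h u v →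
    h ≢ e → L h <ᵀ U e → h ∈ ps →
    Connected ends (Minus G e) u v
lemma3p4 𝒰 _ _ ps _ _ G point h e u v huv h≢e h<e h∈ps =
  connected-weaken (λ c (c∈G , light) → c∈G , light-not-heavy h≢e h<e light)
                   (point-invariant point h h∈ps huv)
  where
  open Walks (EUGraph.ends 𝒰)
  open LightInvariant 𝒰
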